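{- Let $S_1=\{x_1,\dots,x_N\}$ and $S_2=\{y_1,\dots,y_N\}$ be sets of $d$-dimensional $0/1$ vectors. Construct the MDP $P$ with vertex set $\{s\}\cup S_1\cup C\cup S_2$ where $C=\{c_1,\dots,c_d\}$, with edges: $(s,x_i)$ for every $x_i\in S_1$; $(x_i,c_j)$ iff $x_i[j]=1$; $(c_j,y_i)$ iff $y_i[j]=1$; player-1 vertices $V_1=S_1\cup C\cup S_2$ and random vertices $V_R=\{s\}$ (with $\delta(s)$ having support $S_1$). Let the target sets be $T_i=\{y_i\}$ for $i=1,\dots,N$. Then there exist $x\in S_1$, $y\in S_2$ with $\sum_{j=1}^d x[j]y[j]=0$ if and only if there is no almost-sure winning policy from $s$ for the coverage objective with targets $T_1,\dots,T_N$.
   Context: In an MDP, vertices are partitioned into player-1 vertices and random vertices; at a random vertex the successor is chosen according to a probability distribution whose support is the set of out-neighbours, and at a player-1 vertex by a player-1 policy (a function from finite play prefixes ending in a player-1 vertex to an out-neighbour). A policy $\sigma$ and start vertex $s$ induce a probability measure $\Pr_s^\sigma$ on plays; $\sigma$ is almost-sure winning from $s$ for objective $\phi$ if $\Pr_s^\sigma(\phi)=1$. $\mathrm{Reach}(T)$ is the set of plays visiting $T$. There is an almost-sure winning policy from $s$ for the coverage objective with targets $T_1,\dots,T_N$ if for every $i$ there is a player-1 policy (possibly depending on $i$) almost-sure winning from $s$ for $\mathrm{Reach}(T_i)$.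
   Formalization: The distribution $\delta(s)$ at the random vertex s assigns rational probabilities to the vertices of $S_1$. -}

module Defs where

open import Data.Nat as ℕ using (ℕ; zero; suc)
open import Data.Bool using (Bool; true; false; if_then_else_; _∧_)
open import Data.Bool.Properties using () renaming (_≟_ to _≟B_)
open import Data.Fin using (Fin)
open import Data.List using (List; []; _∷_; map; filter; foldr)
open import Data.List.Membership.Propositional using (_∈_)
open import Data.List.Relation.Unary.All using (All)
open import Data.Fin.Properties using () renaming (_≟_ to _≟F_)
open import Data.List.Base using (allFin)
open import Data.Product using (Σ; ∃; _×_; _,_)
open import Relation.Nullary using (¬_; Dec; yes; no)
open import Relation.Binary.PropositionalEquality using (_≡_)
open import Data.Rational as ℚ using (ℚ; 0ℚ; 1ℚ; _-_)

data Owner : Set where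
  player1 random : Owner

sumℚ : ∀ {A : Set} → (A → ℚ) → List A → ℚ
sumℚ f = foldr (λ a r → f a ℚ.+ r) 0ℚ

record MDP : Set₁ where
  field
    V     : Set
    owner : V → Owner
    succs : V → List V
    δ     : V → V → ℚ           -- δ u v : probability of u → v (used at random vertices)
    δ-pos : ∀ u → owner u ≡ random → All (λ v → 0ℚ ℚ.< δ u v) (succs u)
    δ-sum : ∀ u → owner u ≡ random → sumℚ (δ u) (succs u) ≡ 1ℚ

-- A (deterministic, history-dependent) player-1 policy: given the earlier
-- vertices of the play prefix (most recent first) and the current vertex,
-- choose a successor.
Policy : MDP → Set
Policy M = List (MDP.V M) → MDP.V M → MDP.V M

ValidPolicy : (M : MDP) → Policy M → Set
ValidPolicy M σ = ∀ (past : List V) (u : V) → owner u ≡ player1 →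
                  ¬ (succs u ≡ []) → σ past u ∈ succs u
  where open MDP M

-- Target sets are given by decidable predicates (Boolean membership).
-- reachWithin M σ T k past u = Pr^σ (the play visits T within k steps |
-- the current prefix is past,u).  Plays reaching a vertex without
-- out-neighbours stop there (and then no longer can reach T).
reachWithin : (M : MDP) → Policy M → (MDP.V M → Bool) → ℕ →
              List (MDP.V M) → MDP.V M → ℚ
reachWithin M σ T k past u with T u
... | true = 1ℚ
reachWithin M σ T zero past u | false = 0ℚ
reachWithin M σ T (suc k) past u | false with MDP.owner M u | MDP.succs M u
... | _       | []    = 0ℚ
... | player1 | _ ∷ _ = reachWithin M σ T k (u ∷ past) (σ past u)
... | random  | vs@(_ ∷ _) =
        sumℚ (λ v → MDP.δ M u v ℚ.* reachWithin M σ T k (u ∷ past) v) vs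

-- Pr^σ_s(Reach T) = sup_k Pr^σ_s(reach T within k steps) (continuity of the
-- measure from below).  Almost-sure: this supremum equals 1, i.e. for every
-- rational ε > 0 some k gives probability ≥ 1 - ε.
AlmostSureReach : (M : MDP) → Policy M → MDP.V M → (MDP.V M → Bool) → Set
AlmostSureReach M σ s T =
  ∀ (ε : ℚ) → 0ℚ ℚ.< ε → ∃ λ k → (1ℚ - ε) ℚ.≤ reachWithin M σ T k [] s

AlmostSureCoverage : (M : MDP) → MDP.V M → ∀ {N} → (Fin N → MDP.V M → Bool) → Set
AlmostSureCoverage M s Ts =
  ∀ i → Σ (Policy M) λ σ → ValidPolicy M σ × AlmostSureReach M σ s (Ts i)

BVec : ℕ → Set
BVec d = Fin d → Bool

b2n : Bool → ℕ
b2n true  = 1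
b2n false = 0

dot : ∀ {d} → BVec d → BVec d → ℕ
dot {d} x y = foldr ℕ._+_ 0 (map (λ j → b2n (x j) ℕ.* b2n (y j)) (allFin d))

data OVVertex (N d : ℕ) : Set where
  s  : OVVertex N d
  xv : Fin N → OVVertex N d
  cv : Fin d → OVVertex N d
  yv : Fin N → OVVertex N d

ovOwner : ∀ {N d} → OVVertex N d → Owner
ovOwner s = random
ovOwner (xv _) = player1
ovOwner (cv _) = player1
ovOwner (yv _) = player1

ovSuccs : ∀ {N d} → (Fin N → BVec d) → (Fin N → BVec d) → OVVertex N d → List (OVVertex N d)
ovSuccs {N} {d} xs ys s = map xv (allFin N)
ovSuccs {N} {d} xs ys (xv i) = map cv (filter (λ j → xs i j ≟B true) (allFin d))
ovSuccs {N} {d} xs ys (cv j) = map yv (filter (λ i → ys i j ≟B true) (allFin N))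
ovSuccs xs ys (yv _) = []

ovδ : ∀ {N d} → (Fin N → ℚ) → OVVertex N d → OVVertex N d → ℚ
ovδ p s (xv i) = p i
ovδ p _ _ = 0ℚ

ovMDP : ∀ {N d} → (xs ys : Fin N → BVec d) → (p : Fin N → ℚ) →
        (∀ i → 0ℚ ℚ.< p i) → sumℚ p (allFin N) ≡ 1ℚ → MDP
ovMDP {N} {d} xs ys p ppos psum = record
  { V = OVVertex N d
  ; owner = ovOwner
  ; succs = ovSuccs xs ys
  ; δ = ovδ p
  ; δ-pos = pos
  ; δ-sum = sm
  }
  where
  open import Data.List.Relation.Unary.All using ([]; _∷_)
  open import Data.List.Relation.Unary.All.Properties using (map⁺; tabulate⁺)
  open import Relation.Binary.PropositionalEquality using (refl)
  open import Data.List.Properties using (foldr-map)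
  pos : ∀ u → ovOwner u ≡ random → All (λ v → 0ℚ ℚ.< ovδ p u v) (ovSuccs xs ys u)
  pos s _ = map⁺ (allPos (allFin N))
    where
    allPos : (is : List (Fin N)) → All (λ i → 0ℚ ℚ.< p i) is
    allPos [] = []
    allPos (i ∷ is) = ppos i ∷ allPos is
  sm : ∀ u → ovOwner u ≡ random → sumℚ (ovδ p u) (ovSuccs xs ys u) ≡ 1ℚ
  sm s _ = Relation.Binary.PropositionalEquality.trans (lem (allFin N)) psum
    where
    import Relation.Binary.PropositionalEquality
    lem : (is : List (Fin N)) → sumℚ (ovδ {N} {d} p s) (map xv is) ≡ sumℚ p is
    lem [] = refl
    lem (i ∷ is) = Relation.Binary.PropositionalEquality.cong (p i ℚ.+_) (lem is)

ovTarget : ∀ {N d} → Fin N → OVVertex N d → Bool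
ovTarget i (yv k) with i ≟F k
... | yes _ = true
... | no  _ = false
ovTarget i _ = false

{-# OPTIONS --safe #-}
-- If x_i · y_k = 0, every vertex reachable from x_i avoids y_k, so under any policy the
-- play is trapped with probability at least δ(s)(x_i) > 0 and Reach(T_k) is not almost
-- sure.  Otherwise, for each k the memoryless policy that moves from x_i to a coordinate
-- c_j shared with y_k, and from there to y_k, visits y_k within three steps surely.
module Submission where

open import Defs
open import Data.Nat using (ℕ; zero; suc)
open import Data.Fin using (Fin)
open import Data.Product using (∃₂; _×_)
open import Data.List.Base using (allFin)
open import Relation.Nullary using (¬_)
open import Relation.Binary.PropositionalEquality using (_≡_)
open import Data.Rational using (ℚ; 0ℚ; 1ℚ; _<_)
open import Function.Bundles using (_⇔_)

open import Data.Bool using (Bool; true; false)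
open import Data.Bool.Properties using () renaming (_≟_ to _≟B_)
open import Data.Empty using (⊥; ⊥-elim)
open import Data.Fin.Properties using (any?) renaming (_≟_ to _≟F_)
open import Data.Integer using (+<+)
open import Data.List using (List; []; _∷_; map; foldr)
open import Data.List.Membership.Propositional using (_∈_; find; lose)
open import Data.List.Membership.Propositional.Properties
  using (∈-allFin; ∈-map⁺; ∈-map⁻; ∈-filter⁺; ∈-filter⁻)
open import Data.List.Relation.Unary.All as All using (All; []; _∷_)
open import Data.List.Relation.Unary.Any as Any using (Any; here; there)
open import Data.Nat as ℕ using (s≤s; z≤n)
open import Data.Nat.Properties using (m+n≡0⇒n≡0)
open import Data.Product using (∃; _,_; proj₁; proj₂)
open import Data.Rational as ℚ using (_≤_; _+_; _*_; _-_; -_; ½; *<*)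
open import Data.Rational.Properties
  using (≤-refl; ≤-reflexive; ≤-trans; <⇒≤; <-irrefl; +-mono-≤; +-monoʳ-≤; +-monoˡ-≤;
         +-monoʳ-<; +-identityˡ; +-identityʳ; +-comm; +-assoc; +-inverseˡ; *-identityʳ;
         *-zeroʳ; *-monoˡ-≤-nonNeg; *-monoʳ-<-pos; neg-antimono-≤; nonNegative⁻¹;
         positive⁻¹; pos*pos⇒pos; module ≤-Reasoning)
open import Data.Sum using (_⊎_; inj₁; inj₂)
open import Function using (case_of_)
open import Function.Bundles using (mk⇔)
open import Relation.Binary.PropositionalEquality using (refl; sym; trans; subst; cong; cong₂)
open import Relation.Nullary using (Dec; yes; no)
open import Relation.Nullary.Decidable using (decidable-stable)
open import Relation.Unary using (Decidable)

open ≤-Reasoning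

0≤1 : 0ℚ ≤ 1ℚ
0≤1 = nonNegative⁻¹ 1ℚ

½<1 : ½ < 1ℚ
½<1 = *<* (+<+ (s≤s (s≤s z≤n)))

1-ε+ε≡1 : ∀ ε → 1ℚ - ε + ε ≡ 1ℚ
1-ε+ε≡1 ε = begin-equality
  1ℚ - ε + ε     ≡⟨ +-assoc 1ℚ (- ε) ε ⟩
  1ℚ + (- ε + ε) ≡⟨ cong (1ℚ +_) (+-inverseˡ ε) ⟩
  1ℚ + 0ℚ        ≡⟨ +-identityʳ 1ℚ ⟩
  1ℚ             ∎

1-ε≤1 : ∀ {ε} → 0ℚ ≤ ε → 1ℚ - ε ≤ 1ℚ
1-ε≤1 {ε} 0≤ε = subst (1ℚ - ε ≤_) (+-identityʳ 1ℚ) (+-monoʳ-≤ 1ℚ (neg-antimono-≤ 0≤ε))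

f*r≤f : ∀ {f r} → 0ℚ ≤ f → r ≤ 1ℚ → f * r ≤ f
f*r≤f {f} {r} 0≤f r≤1 =
  subst (f * r ≤_) (*-identityʳ f) (*-monoˡ-≤-nonNeg f {{ℚ.nonNegative 0≤f}} r≤1)

module _ {A : Set} (f r : A → ℚ) where

  sumℚ-*-≤ : ∀ {l} → All (λ a → 0ℚ ≤ f a) l → (∀ a → r a ≤ 1ℚ) →
             sumℚ (λ a → f a * r a) l ≤ sumℚ f l
  sumℚ-*-≤ []           r≤1 = ≤-refl
  sumℚ-*-≤ (0≤fa ∷ 0≤f) r≤1 = +-mono-≤ (f*r≤f 0≤fa (r≤1 _)) (sumℚ-*-≤ 0≤f r≤1)

  sumℚ-*-+-≤ : ∀ {l w} → All (λ a → 0ℚ ≤ f a) l → (∀ a → r a ≤ 1ℚ) →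
               w ∈ l → r w ≡ 0ℚ → sumℚ (λ a → f a * r a) l + f w ≤ sumℚ f l
  sumℚ-*-+-≤ {a ∷ l} {w} (_ ∷ 0≤f) r≤1 (here refl) rw≡0 =
    ≤-trans (≤-reflexive drop-w) (+-monoʳ-≤ (f w) (sumℚ-*-≤ 0≤f r≤1))
    where
    S : ℚ
    S = sumℚ (λ a → f a * r a) l
    drop-w : f w * r w + S + f w ≡ f w + S
    drop-w rewrite rw≡0 | *-zeroʳ (f w) | +-identityˡ S = +-comm S (f w)
  sumℚ-*-+-≤ {a ∷ l} {w} (0≤fa ∷ 0≤f) r≤1 (there w∈l) rw≡0 =
    ≤-trans (≤-reflexive (+-assoc (f a * r a) _ (f w)))
            (+-mono-≤ (f*r≤f 0≤fa (r≤1 a)) (sumℚ-*-+-≤ 0≤f r≤1 w∈l rw≡0))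

  sumℚ-*-zero : ∀ {l} → (∀ {a} → a ∈ l → r a ≡ 0ℚ) → sumℚ (λ a → f a * r a) l ≡ 0ℚ
  sumℚ-*-zero {[]}    r≡0 = refl
  sumℚ-*-zero {a ∷ l} r≡0
    rewrite r≡0 (here refl) | *-zeroʳ (f a) | sumℚ-*-zero {l} (λ a∈l → r≡0 (there a∈l)) = refl

  sumℚ-*-one : ∀ {l} → (∀ {a} → a ∈ l → r a ≡ 1ℚ) → sumℚ (λ a → f a * r a) l ≡ sumℚ f l
  sumℚ-*-one {[]}    r≡1 = refl
  sumℚ-*-one {a ∷ l} r≡1 =
    cong₂ _+_ (subst (λ x → f a * x ≡ f a) (sym (r≡1 (here refl))) (*-identityʳ (f a)))
              (sumℚ-*-one (λ a∈l → r≡1 (there a∈l)))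

module Reachability (M : MDP) (T : MDP.V M → Bool) where
  open MDP M

  record IsTrap (B : V → Set) : Set where
    field
      closed : ∀ {u v} → B u → v ∈ succs u → B v
      avoids : ∀ {u} → B u → T u ≡ false

  δ-nonNeg : ∀ {u} → owner u ≡ random → All (λ v → 0ℚ ≤ δ u v) (succs u)
  δ-nonNeg rnd = All.map <⇒≤ (δ-pos _ rnd)

  δ-weighted-≤1 : ∀ {u} {r : V → ℚ} → owner u ≡ random → (∀ v → r v ≤ 1ℚ) →
                  sumℚ (λ v → δ u v * r v) (succs u) ≤ 1ℚ
  δ-weighted-≤1 {u} {r} rnd r≤1 = begin
    sumℚ (λ v → δ u v * r v) (succs u) ≤⟨ sumℚ-*-≤ (δ u) r (δ-nonNeg rnd) r≤1 ⟩
    sumℚ (δ u) (succs u)                ≡⟨ δ-sum u rnd ⟩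
    1ℚ                                  ∎

  δ-weighted-+-≤1 : ∀ {u w} {r : V → ℚ} → owner u ≡ random → w ∈ succs u →
                    (∀ v → r v ≤ 1ℚ) → r w ≡ 0ℚ →
                    sumℚ (λ v → δ u v * r v) (succs u) + δ u w ≤ 1ℚ
  δ-weighted-+-≤1 {u} {w} {r} rnd w∈ r≤1 rw≡0 = begin
    sumℚ (λ v → δ u v * r v) (succs u) + δ u w
      ≤⟨ sumℚ-*-+-≤ (δ u) r (δ-nonNeg rnd) r≤1 w∈ rw≡0 ⟩
    sumℚ (δ u) (succs u)
      ≡⟨ δ-sum u rnd ⟩
    1ℚ ∎

  ¬AlmostSureReach-of-gap : ∀ {σ u q} → 0ℚ < q →
                            (∀ k → reachWithin M σ T k [] u + q ≤ 1ℚ) →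
                            ¬ AlmostSureReach M σ u T
  ¬AlmostSureReach-of-gap {σ} {u} {q} 0<q gap asr =
    let k , 1-ε≤reach = asr ε 0<ε in
    <-irrefl refl (begin-strict
      1ℚ                           ≡⟨ sym (1-ε+ε≡1 ε) ⟩
      1ℚ - ε + ε                   <⟨ +-monoʳ-< (1ℚ - ε) ε<q ⟩
      1ℚ - ε + q                   ≤⟨ +-monoˡ-≤ q 1-ε≤reach ⟩
      reachWithin M σ T k [] u + q ≤⟨ gap k ⟩
      1ℚ                           ∎)
    where
    instance
      q-positive : ℚ.Positive q
      q-positive = ℚ.positive 0<q
    ε : ℚ
    ε = q * ½
    0<ε : 0ℚ < ε
    0<ε = positive⁻¹ ε {{pos*pos⇒pos q ½}}
    ε<q : ε < q
    ε<q = subst (ε <_) (*-identityʳ q) (*-monoʳ-<-pos q ½<1)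

  module _ (σ : Policy M) where

    reach : ℕ → List V → V → ℚ
    reach = reachWithin M σ T

    reachWithin-target : ∀ {k past u} → T u ≡ true → reach k past u ≡ 1ℚ
    reachWithin-target {u = u} Tu rewrite Tu = refl

    reachWithin-zero : ∀ {past u} → T u ≡ false → reach 0 past u ≡ 0ℚ
    reachWithin-zero {u = u} ¬Tu rewrite ¬Tu = refl

    reachWithin-deadEnd : ∀ {k past u} → T u ≡ false → succs u ≡ [] →
                          reach (suc k) past u ≡ 0ℚ
    reachWithin-deadEnd {u = u} ¬Tu deadEnd rewrite ¬Tu | deadEnd with owner u
    ... | player1 = refl
    ... | random  = refl

    reachWithin-player1 : ∀ {k past u} → T u ≡ false → owner u ≡ player1 →
                          σ past u ∈ succs u →
                          reach (suc k) past u ≡ reach k (u ∷ past) (σ past u)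
    reachWithin-player1 {u = u} ¬Tu p1 σ∈ rewrite ¬Tu | p1 with succs u | σ∈
    ... | _ ∷ _ | _ = refl

    reachWithin-random : ∀ {k past u} → T u ≡ false → owner u ≡ random →
                         reach (suc k) past u ≡
                           sumℚ (λ v → δ u v * reach k (u ∷ past) v) (succs u)
    reachWithin-random {u = u} ¬Tu rnd rewrite ¬Tu | rnd with succs u
    ... | []    = refl
    ... | _ ∷ _ = refl

    reachWithin-≤1 : ∀ k past u → reach k past u ≤ 1ℚ
    reachWithin-≤1 k past u with T u in Tu
    ... | true = ≤-refl
    reachWithin-≤1 zero    past u | false = 0≤1
    reachWithin-≤1 (suc k) past u | false with owner u in rnd | succs u in succs-u
    ... | _       | []    = 0≤1
    ... | player1 | _ ∷ _ = reachWithin-≤1 k (u ∷ past) (σ past u)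
    ... | random  | _ ∷ _ =
      subst (λ vs → sumℚ (λ v → δ u v * reach k (u ∷ past) v) vs ≤ 1ℚ) succs-u
            (δ-weighted-≤1 rnd (reachWithin-≤1 k (u ∷ past)))

    reachWithin-random-sure : ∀ {k past u} → T u ≡ false → owner u ≡ random →
                              (∀ {v} → v ∈ succs u → reach k (u ∷ past) v ≡ 1ℚ) →
                              reach (suc k) past u ≡ 1ℚ
    reachWithin-random-sure {k} {past} {u} ¬Tu rnd sure = begin-equality
      reach (suc k) past u                                ≡⟨ reachWithin-random ¬Tu rnd ⟩
      sumℚ (λ v → δ u v * reach k (u ∷ past) v) (succs u) ≡⟨ sumℚ-*-one (δ u) _ sure ⟩
      sumℚ (δ u) (succs u)                                ≡⟨ δ-sum u rnd ⟩
      1ℚ                                                  ∎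

    sure⇒AlmostSureReach : ∀ {k u} → reach k [] u ≡ 1ℚ → AlmostSureReach M σ u T
    sure⇒AlmostSureReach {k} sure ε 0<ε = k , subst (1ℚ - ε ≤_) (sym sure) (1-ε≤1 (<⇒≤ 0<ε))

    module _ {B : V → Set} (trap : IsTrap B) (valid : ValidPolicy M σ) where
      open IsTrap trap

      reachWithin-trap : ∀ k past {u} → B u → reach k past u ≡ 0ℚ
      reachWithin-trap zero    past b = reachWithin-zero (avoids b)
      reachWithin-trap (suc k) past {u} b with owner u in own | succs u in succs-u
      ... | random  | _     =
        trans (reachWithin-random (avoids b) own)
              (sumℚ-*-zero (δ u) _ (λ v∈ → reachWithin-trap k (u ∷ past) (closed b v∈)))
      ... | player1 | []    = reachWithin-deadEnd (avoids b) succs-u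
      ... | player1 | _ ∷ _ =
        trans (reachWithin-player1 (avoids b) own σ∈)
              (reachWithin-trap k (u ∷ past) (closed b σ∈))
        where
        σ∈ : σ past u ∈ succs u
        σ∈ = valid past u own (λ succs-u≡[] → case trans (sym succs-u) succs-u≡[] of λ ())

      reachWithin-+δ-≤1 : ∀ {u w} → T u ≡ false → owner u ≡ random → w ∈ succs u → B w →
                          ∀ k past → reach k past u + δ u w ≤ 1ℚ
      reachWithin-+δ-≤1 {u} {w} ¬Tu rnd w∈ bw zero past = begin
        reach 0 past u + δ u w
          ≡⟨ cong (_+ δ u w) (trans (reachWithin-zero ¬Tu) (sym no-gain)) ⟩
        sumℚ (λ v → δ u v * 0ℚ) (succs u) + δ u w
          ≤⟨ δ-weighted-+-≤1 rnd w∈ (λ _ → 0≤1) refl ⟩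
        1ℚ ∎
        where
        no-gain : sumℚ (λ v → δ u v * 0ℚ) (succs u) ≡ 0ℚ
        no-gain = sumℚ-*-zero (δ u) (λ _ → 0ℚ) {succs u} (λ _ → refl)
      reachWithin-+δ-≤1 {u} {w} ¬Tu rnd w∈ bw (suc k) past = begin
        reach (suc k) past u + δ u w
          ≡⟨ cong (_+ δ u w) (reachWithin-random ¬Tu rnd) ⟩
        sumℚ (λ v → δ u v * reach k (u ∷ past) v) (succs u) + δ u w
          ≤⟨ δ-weighted-+-≤1 rnd w∈ (reachWithin-≤1 k (u ∷ past))
                                    (reachWithin-trap k (u ∷ past) bw) ⟩
        1ℚ ∎

      trap-successor⇒¬AlmostSureReach : ∀ {u w} → T u ≡ false → owner u ≡ random →
                                         w ∈ succs u → B w → ¬ AlmostSureReach M σ u T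
      trap-successor⇒¬AlmostSureReach ¬Tu rnd w∈ bw =
        ¬AlmostSureReach-of-gap (All.lookup (δ-pos _ rnd) w∈)
                                (λ k → reachWithin-+δ-≤1 ¬Tu rnd w∈ bw k [])

module _ {A : Set} {G : A → Set} (G? : Decidable G) where

  choose : A → List A → A
  choose a []       = a
  choose a (v ∷ vs) with Any.any? G? (v ∷ vs)
  ... | yes g = proj₁ (find g)
  ... | no _  = v

  choose-∈ : ∀ {a vs} → ¬ vs ≡ [] → choose a vs ∈ vs
  choose-∈ {vs = []}     vs≢[] = ⊥-elim (vs≢[] refl)
  choose-∈ {vs = v ∷ vs} _ with Any.any? G? (v ∷ vs)
  ... | yes g = proj₁ (proj₂ (find g))
  ... | no _  = here refl

  choose-satisfies : ∀ {a vs} → Any G vs → G (choose a vs)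
  choose-satisfies {vs = v ∷ vs} g with Any.any? G? (v ∷ vs)
  ... | yes g′ = proj₂ (proj₂ (find g′))
  ... | no ¬g  = ⊥-elim (¬g g)

module _ {M : MDP} {G : MDP.V M → Set} (G? : Decidable G) where
  open MDP M

  greedy : Policy M
  greedy _ u = choose G? u (succs u)

  greedy-valid : ValidPolicy M greedy
  greedy-valid _ _ _ = choose-∈ G?

  greedy-chooses : ∀ {past u} → Any G (succs u) →
                   greedy past u ∈ succs u × G (greedy past u)
  greedy-chooses g =
    choose-∈ G? (λ succs-u≡[] → case subst (Any G) succs-u≡[] g of λ ()) ,
    choose-satisfies G? g

module _ {d : ℕ} (x y : BVec d) where

  private
    dotOver : List (Fin d) → ℕ
    dotOver l = foldr ℕ._+_ 0 (map (λ j → b2n (x j) ℕ.* b2n (y j)) l)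

  dot≡0⊎common : dot x y ≡ 0 ⊎ ∃ λ j → x j ≡ true × y j ≡ true
  dot≡0⊎common = go (allFin d)
    where
    go : ∀ l → dotOver l ≡ 0 ⊎ ∃ λ j → x j ≡ true × y j ≡ true
    go []      = inj₁ refl
    go (j ∷ l) with x j in xj | y j in yj
    ... | true  | true  = inj₂ (j , xj , yj)
    ... | true  | false = go l
    ... | false | _     = go l

  dot≡0⇒disjoint : dot x y ≡ 0 → ∀ j → x j ≡ true → y j ≡ true → ⊥
  dot≡0⇒disjoint x·y≡0 j = go (allFin d) x·y≡0 (∈-allFin j)
    where
    go : ∀ l → dotOver l ≡ 0 → j ∈ l → x j ≡ true → y j ≡ true → ⊥
    go (.j ∷ l) sum≡0 (here refl) xj yj rewrite xj | yj = case sum≡0 of λ ()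
    go (i ∷ l)  sum≡0 (there j∈l) = go l (m+n≡0⇒n≡0 (b2n (x i) ℕ.* b2n (y i)) sum≡0) j∈l

module OrthogonalVectors {N d : ℕ} (xs ys : Fin N → BVec d) where

  succs : OVVertex N d → List (OVVertex N d)
  succs = ovSuccs xs ys

  xv∈succs-s : ∀ i → xv i ∈ succs s
  xv∈succs-s i = ∈-map⁺ xv (∈-allFin i)

  cv∈succs-xv : ∀ {i j} → xs i j ≡ true → cv j ∈ succs (xv i)
  cv∈succs-xv {i} {j} xij = ∈-map⁺ cv (∈-filter⁺ (λ j → xs i j ≟B true) (∈-allFin j) xij)

  yv∈succs-cv : ∀ {j k} → ys k j ≡ true → yv k ∈ succs (cv j)
  yv∈succs-cv {j} {k} ykj = ∈-map⁺ yv (∈-filter⁺ (λ k → ys k j ≟B true) (∈-allFin k) ykj)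

  succs-s⁻ : ∀ {v} → v ∈ succs s → ∃ λ i → v ≡ xv i
  succs-s⁻ v∈ = let i , _ , v≡xv = ∈-map⁻ xv v∈ in i , v≡xv

  succs-xv⁻ : ∀ {i v} → v ∈ succs (xv i) → ∃ λ j → v ≡ cv j × xs i j ≡ true
  succs-xv⁻ {i} v∈ =
    let j , j∈ , v≡cv = ∈-map⁻ cv v∈
    in  j , v≡cv , proj₂ (∈-filter⁻ (λ j → xs i j ≟B true) {xs = allFin d} j∈)

  succs-cv⁻ : ∀ {j v} → v ∈ succs (cv j) → ∃ λ k → v ≡ yv k × ys k j ≡ true
  succs-cv⁻ {j} v∈ =
    let k , k∈ , v≡yv = ∈-map⁻ yv v∈
    in  k , v≡yv , proj₂ (∈-filter⁻ (λ k → ys k j ≟B true) {xs = allFin N} k∈)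

  ovTarget-self : ∀ k → ovTarget {N} {d} k (yv k) ≡ true
  ovTarget-self k with k ≟F k
  ... | yes _  = refl
  ... | no k≢k = ⊥-elim (k≢k refl)

  ovTarget-other : ∀ {k k′} → ¬ k ≡ k′ → ovTarget {N} {d} k (yv k′) ≡ false
  ovTarget-other {k} {k′} k≢k′ with k ≟F k′
  ... | yes k≡k′ = ⊥-elim (k≢k′ k≡k′)
  ... | no _     = refl

  Descendant : Fin N → OVVertex N d → Set
  Descendant i s       = ⊥
  Descendant i (xv i′) = i′ ≡ i
  Descendant i (cv j)  = xs i j ≡ true
  Descendant i (yv k)  = ∃ λ j → xs i j ≡ true × ys k j ≡ true

  descendant-closed : ∀ {i u v} → Descendant i u → v ∈ succs u → Descendant i v
  descendant-closed {u = xv _} refl v∈ with succs-xv⁻ v∈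
  ... | j , refl , xij = xij
  descendant-closed {u = cv j} xij v∈ with succs-cv⁻ v∈
  ... | k , refl , ykj = j , xij , ykj

  descendant-avoids : ∀ {i k u} → dot (xs i) (ys k) ≡ 0 → Descendant i u →
                      ovTarget k u ≡ false
  descendant-avoids {u = xv _} _ _ = refl
  descendant-avoids {u = cv _} _ _ = refl
  descendant-avoids {i} {k} {yv k′} xi·yk≡0 (j , xij , yk′j) = ovTarget-other k≢k′
    where
    k≢k′ : ¬ k ≡ k′
    k≢k′ refl = dot≡0⇒disjoint (xs i) (ys k) xi·yk≡0 j xij yk′j

  Near : Fin N → OVVertex N d → Set
  Near k (cv j)  = ys k j ≡ true
  Near k (yv k′) = k′ ≡ k
  Near k _       = ⊥

  near? : ∀ k → Decidable (Near k)
  near? k s       = no λ ()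
  near? k (xv _)  = no λ ()
  near? k (cv j)  = ys k j ≟B true
  near? k (yv k′) = k′ ≟F k

  near-successor⇒target : ∀ {j k v} → v ∈ succs (cv j) → Near k v → ovTarget k v ≡ true
  near-successor⇒target {v = yv k} _  refl = ovTarget-self k
  near-successor⇒target {v = cv _} v∈ _ with succs-cv⁻ v∈
  ... | _ , () , _

  module _ (p : Fin N → ℚ) (ppos : ∀ i → 0ℚ < p i) (psum : sumℚ p (allFin N) ≡ 1ℚ) where

    M : MDP
    M = ovMDP xs ys p ppos psum

    orthogonal⇒¬coverage : (∃₂ λ i k → dot (xs i) (ys k) ≡ 0) →
                           ¬ AlmostSureCoverage M s ovTarget
    orthogonal⇒¬coverage (i , k , xi·yk≡0) cover =
      let σ , valid , wins = cover k in
      trap-successor⇒¬AlmostSureReach σ descendants-trap valid refl refl (xv∈succs-s i) refl wins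
      where
      open Reachability M (ovTarget k)
      descendants-trap : IsTrap (Descendant i)
      descendants-trap = record { closed = descendant-closed
                                ; avoids = descendant-avoids xi·yk≡0 }

    towards : Fin N → Policy M
    towards k = greedy {M = M} (near? k)

    module _ (k : Fin N) where
      open Reachability M (ovTarget k)

      σ : Policy M
      σ = towards k

      reach-1-from-near : ∀ {u} → Near k u → ∀ past → reach σ 1 past u ≡ 1ℚ
      reach-1-from-near {yv _} refl past = reachWithin-target σ (ovTarget-self k)
      reach-1-from-near {cv j} ykj  past =
        let σ∈ , near = greedy-chooses {M = M} (near? k) {past} {cv j}
                                       (lose (yv∈succs-cv ykj) refl)
        in trans (reachWithin-player1 σ {0} {past} {cv j} refl refl σ∈)
                 (reachWithin-target σ {0} {cv j ∷ past} {σ past (cv j)}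
                                     (near-successor⇒target σ∈ near))

      reach-2-from-x : ∀ {i j} → xs i j ≡ true → ys k j ≡ true →
                       ∀ past → reach σ 2 past (xv i) ≡ 1ℚ
      reach-2-from-x {i} xij ykj past =
        let σ∈ , near = greedy-chooses {M = M} (near? k) {past} {xv i}
                                       (lose (cv∈succs-xv xij) ykj)
        in trans (reachWithin-player1 σ {1} {past} {xv i} refl refl σ∈)
                 (reach-1-from-near near _)

      reach-3-from-s : (∀ i → ∃ λ j → xs i j ≡ true × ys k j ≡ true) → reach σ 3 [] s ≡ 1ℚ
      reach-3-from-s common = reachWithin-random-sure σ {2} {[]} {s} refl refl from-x
        where
        from-x : ∀ {v} → v ∈ succs s → reach σ 2 (s ∷ []) v ≡ 1ℚ
        from-x v∈ with succs-s⁻ v∈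
        ... | i , refl = let j , xij , ykj = common i in reach-2-from-x xij ykj _

    nonorthogonal⇒coverage : (∀ i k → ¬ dot (xs i) (ys k) ≡ 0) →
                             AlmostSureCoverage M s ovTarget
    nonorthogonal⇒coverage xi·yk≢0 k =
      towards k , greedy-valid {M = M} (near? k) ,
      Reachability.sure⇒AlmostSureReach M (ovTarget k) (towards k) {3} {s}
                                        (reach-3-from-s k common)
      where
      common : ∀ i → ∃ λ j → xs i j ≡ true × ys k j ≡ true
      common i with dot≡0⊎common (xs i) (ys k)
      ... | inj₁ xi·yk≡0 = ⊥-elim (xi·yk≢0 i k xi·yk≡0)
      ... | inj₂ j       = j

    orthogonal? : Dec (∃₂ λ i k → dot (xs i) (ys k) ≡ 0)
    orthogonal? = any? λ i → any? λ k → dot (xs i) (ys k) ℕ.≟ 0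

    ¬coverage⇒orthogonal : ¬ AlmostSureCoverage M s ovTarget →
                           ∃₂ λ i k → dot (xs i) (ys k) ≡ 0
    ¬coverage⇒orthogonal ¬cover = decidable-stable orthogonal? λ ¬orthogonal →
      ¬cover (nonorthogonal⇒coverage λ i k xi·yk≡0 → ¬orthogonal (i , k , xi·yk≡0))

mainTheorem9 : (N d : ℕ) (xs ys : Fin N → BVec d)
    (p : Fin N → ℚ) (ppos : ∀ i → 0ℚ < p i) (psum : sumℚ p (allFin N) ≡ 1ℚ) →
    (∃₂ λ i k → dot (xs i) (ys k) ≡ 0)
      ⇔ (¬ AlmostSureCoverage (ovMDP xs ys p ppos psum) s ovTarget)
mainTheorem9 N d xs ys p ppos psum =
  mk⇔ (orthogonal⇒¬coverage p ppos psum) (¬coverage⇒orthogonal p ppos psum)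
  where open OrthogonalVectors xs ys
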